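{- Let $G$ be a connected graph with $|V(G)|\ge 2$ and let $F$ be a graph with $|V(F)|\ge 2$. Then the lexicographic product $G[F]$ is well $\gamma_t$-dominated if and only if one of the following holds: (i) $G$ is complete and $F$ is well $\gamma_t$-dominated with $\gamma_t(F)=2$; (ii) $G$ is well $\gamma_t$-dominated and $\delta(F)=0$.
   Context: All graphs are finite, simple and undirected; $\delta(H)$ is the minimum degree. The lexicographic product $G[F]$ has vertex set $V(G)\times V(F)$, with $(g,f)$ adjacent to $(g',f')$ iff $gg'\in E(G)$, or $g=g'$ and $ff'\in E(F)$. A total dominating set of $H$ is a set $S$ such that every vertex of $H$ has a neighbor in $S$; it is minimal if no proper subset is total dominating. $\gamma_t(H)$ is the minimum and $\Gamma_t(H)$ the maximum cardinality of a minimal total dominating set; $H$ is well $\gamma_t$-dominated if $\gamma_t(H)=\Gamma_t(H)$. -}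

module Defs where

open import Data.Nat using (ℕ; _≤_)
open import Data.Bool using (Bool; true; false; _∨_; _∧_)
open import Data.Fin using (Fin; remQuot; _≟_)
open import Data.Fin.Subset using (Subset; _∈_; _⊂_; ∣_∣)
open import Data.Product using (Σ; ∃; _×_; _,_; proj₁; proj₂)
open import Relation.Nullary using (¬_; yes; no)
open import Relation.Nullary.Decidable using (⌊_⌋)
open import Relation.Binary.PropositionalEquality using (_≡_; _≢_; refl; sym; cong₂)

record Graph : Set where
  field
    n      : ℕ
    adj    : Fin n → Fin n → Bool
    adj-sym    : ∀ u v → adj u v ≡ adj v u
    adj-irrefl : ∀ v → adj v v ≡ false
open Graph public

-- Lexicographic product G[F]: vertex (g,f) is encoded by Fin (n G * n F)
-- via remQuot (a bijection, inverse `combine`).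
-- (g,f) ~ (g',f')  iff  g g' ∈ E(G)  or  (g = g' and f f' ∈ E(F)).
private
  ≟-sym : ∀ {m} (a b : Fin m) → ⌊ a ≟ b ⌋ ≡ ⌊ b ≟ a ⌋
  ≟-sym a b with a ≟ b | b ≟ a
  ... | yes _ | yes _ = refl
  ... | no _  | no _  = refl
  ... | yes p | no q  = Data.Empty.⊥-elim (q (sym p)) where import Data.Empty
  ... | no p  | yes q = Data.Empty.⊥-elim (p (sym q)) where import Data.Empty

  ≟-refl : ∀ {m} (a : Fin m) → ⌊ a ≟ a ⌋ ≡ true
  ≟-refl a with a ≟ a
  ... | yes _ = refl
  ... | no p  = Data.Empty.⊥-elim (p refl) where import Data.Empty

lexAdj₀ : (G F : Graph) → (Fin (n G) × Fin (n F)) → (Fin (n G) × Fin (n F)) → Bool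
lexAdj₀ G F (g , f) (g' , f') = adj G g g' ∨ (⌊ g ≟ g' ⌋ ∧ adj F f f')

lexAdj : (G F : Graph) → Fin (n G Data.Nat.* n F) → Fin (n G Data.Nat.* n F) → Bool
lexAdj G F x y = lexAdj₀ G F (remQuot {n G} (n F) x) (remQuot {n G} (n F) y)

private
  lexAdj₀-sym : ∀ G F p q → lexAdj₀ G F p q ≡ lexAdj₀ G F q p
  lexAdj₀-sym G F (g , f) (g' , f') =
    cong₂ _∨_ (adj-sym G g g') (cong₂ _∧_ (≟-sym g g') (adj-sym F f f'))

  lexAdj₀-irrefl : ∀ G F p → lexAdj₀ G F p p ≡ false
  lexAdj₀-irrefl G F (g , f) rewrite adj-irrefl G g | ≟-refl g | adj-irrefl F f = refl

  lexAdj-sym : ∀ G F x y → lexAdj G F x y ≡ lexAdj G F y x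
  lexAdj-sym G F x y = lexAdj₀-sym G F _ _

  lexAdj-irrefl : ∀ G F x → lexAdj G F x x ≡ false
  lexAdj-irrefl G F x = lexAdj₀-irrefl G F _

lex : Graph → Graph → Graph
lex G F = record
  { n = n G Data.Nat.* n F
  ; adj = lexAdj G F
  ; adj-sym = lexAdj-sym G F
  ; adj-irrefl = lexAdj-irrefl G F
  }

data Reach (G : Graph) : Fin (n G) → Fin (n G) → Set where
  here : ∀ {u} → Reach G u u
  step : ∀ {u v w} → adj G u v ≡ true → Reach G v w → Reach G u w

Connected : Graph → Set
Connected G = ∀ u v → Reach G u v

Complete : Graph → Set
Complete G = ∀ u v → u ≢ v → adj G u v ≡ true

MinDegreeZero : Graph → Set
MinDegreeZero G = ∃ λ v → ∀ w → adj G v w ≡ false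

IsTDS : (G : Graph) → Subset (n G) → Set
IsTDS G S = ∀ v → ∃ λ u → u ∈ S × adj G v u ≡ true

IsMinimalTDS : (G : Graph) → Subset (n G) → Set
IsMinimalTDS G S = IsTDS G S × (∀ T → T ⊂ S → ¬ IsTDS G T)

GammaT : Graph → ℕ → Set
GammaT G k = (∃ λ S → IsMinimalTDS G S × ∣ S ∣ ≡ k)
           × (∀ S → IsMinimalTDS G S → k ≤ ∣ S ∣)

UpperGammaT : Graph → ℕ → Set
UpperGammaT G k = (∃ λ S → IsMinimalTDS G S × ∣ S ∣ ≡ k)
                × (∀ S → IsMinimalTDS G S → ∣ S ∣ ≤ k)

WellTotalDominated : Graph → Set
WellTotalDominated G = ∃ λ k → GammaT G k × UpperGammaT G k

-- If F has an isolated vertex f₀, the vertices (h , f₀) of G[F] are dominated only along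
-- edges of G. Hence a minimal total dominating set of G[F] meets every G-layer in at most one
-- vertex and projects onto a minimal TDS of G of the same size, while D ↦ D × {f₀} maps minimal
-- TDSs of G to minimal TDSs of G[F]: the two graphs have the same minimal-TDS sizes.
-- If F has no isolated vertex and G is complete, a minimal TDS of G[F] consists either of two
-- vertices in different layers or of a copy {g} × T of a minimal TDS T of F, and both kinds occur.
-- Otherwise the connected graph G has an induced path a b c. For a maximal independent set
-- I ∋ a, c and a minimal TDS T of F, I × T is a minimal TDS of G[F]; replacing its layers over a
-- and c by one vertex over each of a, b, c leaves a strictly smaller TDS, and a minimal TDS
-- inside it has fewer than |I × T| vertices.

module Submission where

open import Defs
open import Data.Bool using (Bool; true; false; _∧_; _∨_)
import Data.Bool as Bool
open import Data.Bool.Properties using (¬-not; not-¬)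
open import Data.Fin using (Fin; zero; suc; combine; _↑ˡ_; _↑ʳ_; _≟_)
open import Data.Fin.Properties
  using (any?; all?; ¬∀⟶∃¬; remQuot-combine; combine-surjective; combine-injective)
open import Data.Fin.Subset
  using (Subset; inside; outside; _∈_; _∉_; _⊆_; _⊂_; _⊃_; ∣_∣; ⁅_⁆; _∪_; _∩_; _─_; _-_; ⊤)
open import Data.Fin.Subset.Induction using (Acc; acc; ⊂-wellFounded; ⊃-wellFounded)
open import Data.Fin.Subset.Properties
  using (_∈?_; nonempty?; ∈⊤; x∈⁅x⁆; x∈⁅y⁆⇒x≡y; x≢y⇒x∉⁅y⁆; x∉⁅y⁆⇒x≢y; ∣⁅x⁆∣≡1; ∣⊥∣≡0; ∣p∣≤∣x∷p∣;
         p⊆p∪q; q⊆p∪q; x∈p∪q⁻; x∈p∩q⁺; p∩q⊆p; p∩q⊆q; p─q⊆p; x∈p∧x≢y⇒x∈p-y; x∈p⇒p-x⊂p;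
         x∈p⇒∣p-x∣<∣p∣; p⊂q⇒∣p∣<∣q∣; p⊆q⇒∣p∣≤∣q∣; ⊆-antisym; Empty-unique)
open import Data.Nat using (ℕ; zero; suc; _+_; _*_; _≤_; _<_; z≤n; s≤s)
open import Data.Nat.Properties
  using (≤-antisym; ≤-trans; ≤-reflexive; <-irrefl; ≤-<-trans; <-≤-trans; +-assoc; +-comm; +-suc; +-identityʳ;
         *-identityʳ; +-mono-≤; +-monoʳ-≤; +-monoʳ-<; *-monoˡ-≤; +-*-semiring; module ≤-Reasoning)
open import Algebra.Properties.Semiring.Sum +-*-semiring
  using (sum-syntax; sum-cong-≗; sum-replicate-zero; *-distribʳ-sum)
open import Data.Product using (Σ; ∃; ∃₂; _×_; _,_; proj₁; proj₂)
open import Data.Sum using (_⊎_; inj₁; inj₂)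
open import Data.Vec using ([]; _∷_; here; there; map; lookup; tabulate; _⊛*_)
open import Data.Vec.Properties using (lookup∘tabulate; lookup⇒[]=; []=⇒lookup; lookup-⊛*; lookup-map)
open import Function using (id; _∘_; _⇔_; mk⇔; Equivalence)
open import Relation.Nullary using (¬_; Dec; yes; no; does; _×-dec_; _→-dec_; ¬?; contradiction)
open import Relation.Nullary.Decidable using (⌊_⌋; dec-true)
open import Relation.Binary.PropositionalEquality

x∈p─q⇒x∉q : ∀ {n} {x : Fin n} (p q : Subset n) → x ∈ p ─ q → x ∉ q
x∈p─q⇒x∉q (_ ∷ p) (_      ∷ q) (there x∈p─q) (there x∈q) = x∈p─q⇒x∉q p q x∈p─q x∈q
x∈p─q⇒x∉q (_ ∷ p) (inside ∷ q) ()            here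

x∈p-y⇒x≢y : ∀ {n} {x y : Fin n} (p : Subset n) → x ∈ p - y → x ≢ y
x∈p-y⇒x≢y {y = y} p x∈p-y = x∉⁅y⁆⇒x≢y (x∈p─q⇒x∉q p ⁅ y ⁆ x∈p-y)

x∈p⇒⁅x⁆⊆p : ∀ {n} {x : Fin n} {p : Subset n} → x ∈ p → ⁅ x ⁆ ⊆ p
x∈p⇒⁅x⁆⊆p {x = x} {p} x∈p y∈⁅x⁆ = subst (_∈ p) (sym (x∈⁅y⁆⇒x≡y x y∈⁅x⁆)) x∈p

∈-tabulate⁺ : ∀ {n} {p : Fin n → Bool} {x} → p x ≡ true → x ∈ tabulate p
∈-tabulate⁺ {p = p} {x} px = lookup⇒[]= x (tabulate p) (trans (lookup∘tabulate p x) px)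

∈-tabulate⁻ : ∀ {n} {p : Fin n → Bool} {x} → x ∈ tabulate p → p x ≡ true
∈-tabulate⁻ {p = p} {x} x∈ = trans (sym (lookup∘tabulate p x)) ([]=⇒lookup x∈)

∣p∪q∣≤∣p∣+∣q∣ : ∀ {n} (p q : Subset n) → ∣ p ∪ q ∣ ≤ ∣ p ∣ + ∣ q ∣
∣p∪q∣≤∣p∣+∣q∣ []            []            = z≤n
∣p∪q∣≤∣p∣+∣q∣ (inside  ∷ p) (y       ∷ q) =
  s≤s (≤-trans (∣p∪q∣≤∣p∣+∣q∣ p q) (+-monoʳ-≤ ∣ p ∣ (∣p∣≤∣x∷p∣ y q)))
∣p∪q∣≤∣p∣+∣q∣ (outside ∷ p) (inside  ∷ q) =
  ≤-trans (s≤s (∣p∪q∣≤∣p∣+∣q∣ p q)) (≤-reflexive (sym (+-suc ∣ p ∣ ∣ q ∣)))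
∣p∪q∣≤∣p∣+∣q∣ (outside ∷ p) (outside ∷ q) = ∣p∪q∣≤∣p∣+∣q∣ p q

∣⁅x⁆∪⁅y⁆∣≤2 : ∀ {m} (x y : Fin m) → ∣ ⁅ x ⁆ ∪ ⁅ y ⁆ ∣ ≤ 2
∣⁅x⁆∪⁅y⁆∣≤2 x y = ≤-trans (∣p∪q∣≤∣p∣+∣q∣ ⁅ x ⁆ ⁅ y ⁆) (≤-reflexive (cong₂ _+_ (∣⁅x⁆∣≡1 x) (∣⁅x⁆∣≡1 y)))

𝟙 : Bool → ℕ
𝟙 true  = 1
𝟙 false = 0

∣p∣≡∑𝟙 : ∀ {n} (p : Subset n) → ∣ p ∣ ≡ ∑[ i < n ] 𝟙 (lookup p i)
∣p∣≡∑𝟙 []            = refl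
∣p∣≡∑𝟙 (inside  ∷ p) = cong suc (∣p∣≡∑𝟙 p)
∣p∣≡∑𝟙 (outside ∷ p) = ∣p∣≡∑𝟙 p

∣tabulate∣≡∑𝟙 : ∀ {n} (p : Fin n → Bool) → ∣ tabulate p ∣ ≡ ∑[ i < n ] 𝟙 (p i)
∣tabulate∣≡∑𝟙 p = trans (∣p∣≡∑𝟙 (tabulate p)) (sum-cong-≗ (cong 𝟙 ∘ lookup∘tabulate p))

∑𝟙-∧ : ∀ {n} b (p : Fin n → Bool) → ∑[ i < n ] 𝟙 (b ∧ p i) ≡ 𝟙 b * ∑[ i < n ] 𝟙 (p i)
∑𝟙-∧ true  p = sym (+-identityʳ _)
∑𝟙-∧ {n} false p = sum-replicate-zero n

∑-↑ : ∀ m {n} (h : Fin (m + n) → ℕ) →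
      ∑[ k < m + n ] h k ≡ ∑[ i < m ] h (i ↑ˡ n) + ∑[ j < n ] h (m ↑ʳ j)
∑-↑ zero    h = refl
∑-↑ (suc m) h = trans (cong (h zero +_) (∑-↑ m (h ∘ suc))) (sym (+-assoc (h zero) _ _))

∑-combine : ∀ m {n} (h : Fin (m * n) → ℕ) →
            ∑[ k < m * n ] h k ≡ ∑[ i < m ] ∑[ j < n ] h (combine i j)
∑-combine zero    h = refl
∑-combine (suc m) {n} h =
  trans (∑-↑ n h) (cong (∑[ j < n ] h (j ↑ˡ m * n) +_) (∑-combine m (h ∘ (n ↑ʳ_))))

two-distinct : ∀ {m} → 2 ≤ m → Σ (Fin m) λ x → Σ (Fin m) λ y → x ≢ y
two-distinct (s≤s (s≤s _)) = zero , suc zero , λ ()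

adj⇒≢ : ∀ H {u w : Fin (n H)} → adj H u w ≡ true → u ≢ w
adj⇒≢ H {u} u~u refl = not-¬ u~u (adj-irrefl H u)

NoIsolatedVertex : Graph → Set
NoIsolatedVertex H = ∀ v → ∃ λ w → adj H v w ≡ true

UniformTDS : Graph → ℕ → Set
UniformTDS H k = ∀ S → IsMinimalTDS H S → ∣ S ∣ ≡ k

Independent : (H : Graph) → Subset (n H) → Set
Independent H I = ∀ {g g′} → g ∈ I → g′ ∈ I → adj H g g′ ≡ false

Dominating : (H : Graph) → Subset (n H) → Set
Dominating H I = ∀ h → h ∈ I ⊎ ∃ λ g → g ∈ I × adj H h g ≡ true

record InducedP₃ (H : Graph) : Set where
  field
    a b c : Fin (n H)
    a~b   : adj H a b ≡ true
    b~c   : adj H b c ≡ true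
    a≢c   : a ≢ c
    a≁c   : adj H a c ≡ false

module _ (H : Graph) where

  IsTDS-⊆ : ∀ {S T} → S ⊆ T → IsTDS H S → IsTDS H T
  IsTDS-⊆ S⊆T tds v = let u , u∈S , v~u = tds v in u , S⊆T u∈S , v~u

  IsTDS? : ∀ S → Dec (IsTDS H S)
  IsTDS? S = all? λ v → any? λ u → u ∈? S ×-dec adj H v u Bool.≟ true

  IsTDS⇒2≤∣S∣ : ∀ {S} → Fin (n H) → IsTDS H S → 2 ≤ ∣ S ∣
  IsTDS⇒2≤∣S∣ {S} v tds =
    let u , u∈S , _   = tds v
        w , w∈S , u~w = tds u
        ⁅w⁆⊂S : ⁅ w ⁆ ⊂ S
        ⁅w⁆⊂S = x∈p⇒⁅x⁆⊆p w∈S , u , u∈S , x≢y⇒x∉⁅y⁆ (adj⇒≢ H u~w)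
    in subst (_< ∣ S ∣) (∣⁅x⁆∣≡1 w) (p⊂q⇒∣p∣<∣q∣ ⁅w⁆⊂S)

  irremovable⇒IsMinimalTDS : ∀ {S} → IsTDS H S → (∀ {x} → x ∈ S → ¬ IsTDS H (S - x)) → IsMinimalTDS H S
  irremovable⇒IsMinimalTDS {S} tds irremovable =
    tds , λ T (T⊆S , x , x∈S , x∉T) tdsT →
      irremovable x∈S (IsTDS-⊆ (λ y∈T → x∈p∧x≢y⇒x∈p-y (T⊆S y∈T) (λ { refl → x∉T y∈T })) tdsT)

  minimal⇒TDS⊆-≡ : ∀ {S T} → IsMinimalTDS H S → T ⊆ S → IsTDS H T → T ≡ S
  minimal⇒TDS⊆-≡ {S} {T} (_ , minS) T⊆S tdsT = ⊆-antisym T⊆S S⊆T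
    where
    S⊆T : S ⊆ T
    S⊆T {x} x∈S with x ∈? T
    ... | yes x∈T = x∈T
    ... | no  x∉T = contradiction tdsT (minS T (T⊆S , x , x∈S , x∉T))

  IsTDS⇒∃minimal⊆ : ∀ {S} → IsTDS H S → ∃ λ M → M ⊆ S × IsMinimalTDS H M
  IsTDS⇒∃minimal⊆ = shrink (⊂-wellFounded _)
    where
    shrink : ∀ {S} → Acc _⊂_ S → IsTDS H S → ∃ λ M → M ⊆ S × IsMinimalTDS H M
    shrink {S} (acc smaller) tds with any? (λ x → x ∈? S ×-dec IsTDS? (S - x))
    ... | yes (x , x∈S , tds-x) =
      let M , M⊆S-x , minM = shrink (smaller (x∈p⇒p-x⊂p x∈S)) tds-x
      in M , (λ y∈M → p─q⊆p S ⁅ x ⁆ (M⊆S-x y∈M)) , minM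
    ... | no irremovable = S , id , irremovable⇒IsMinimalTDS tds (λ x∈S tds-x → irremovable (_ , x∈S , tds-x))

  NoIsolatedVertex⇒∃minimal : NoIsolatedVertex H → ∃ (IsMinimalTDS H)
  NoIsolatedVertex⇒∃minimal noIso =
    let M , _ , minM = IsTDS⇒∃minimal⊆ {⊤} (λ v → let w , v~w = noIso v in w , ∈⊤ , v~w)
    in M , minM

  pair-IsTDS⇒minimal : ∀ x y → IsTDS H (⁅ x ⁆ ∪ ⁅ y ⁆) →
                       IsMinimalTDS H (⁅ x ⁆ ∪ ⁅ y ⁆) × ∣ ⁅ x ⁆ ∪ ⁅ y ⁆ ∣ ≡ 2
  pair-IsTDS⇒minimal x y tds =
    (tds , no-smaller) , ≤-antisym (∣⁅x⁆∪⁅y⁆∣≤2 x y) (IsTDS⇒2≤∣S∣ x tds)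
    where
    no-smaller : ∀ T → T ⊂ ⁅ x ⁆ ∪ ⁅ y ⁆ → ¬ IsTDS H T
    no-smaller T T⊂P tdsT =
      <-irrefl refl (≤-<-trans (IsTDS⇒2≤∣S∣ x tdsT) (<-≤-trans (p⊂q⇒∣p∣<∣q∣ T⊂P) (∣⁅x⁆∪⁅y⁆∣≤2 x y)))

  WellTotalDominated⇒uniform : WellTotalDominated H → ∃ (UniformTDS H)
  WellTotalDominated⇒uniform (k , (_ , k≤) , (_ , ≤k)) = k , λ S minS → ≤-antisym (≤k S minS) (k≤ S minS)

  uniform⇒GammaT : ∀ {k} → NoIsolatedVertex H → UniformTDS H k → GammaT H k
  uniform⇒GammaT noIso uni =
    let S , minS = NoIsolatedVertex⇒∃minimal noIso
    in (S , minS , uni S minS) , λ T minT → ≤-reflexive (sym (uni T minT))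

  uniform⇒WellTotalDominated : ∀ {k} → NoIsolatedVertex H → UniformTDS H k → WellTotalDominated H
  uniform⇒WellTotalDominated {k} noIso uni =
    let S , minS = NoIsolatedVertex⇒∃minimal noIso
    in k , uniform⇒GammaT noIso uni , (S , minS , uni S minS) , λ T minT → ≤-reflexive (uni T minT)

  isolated-or-NoIsolatedVertex : MinDegreeZero H ⊎ NoIsolatedVertex H
  isolated-or-NoIsolatedVertex with any? (λ v → all? (λ w → adj H v w Bool.≟ false))
  ... | yes isolated = inj₁ isolated
  ... | no ¬isolated = inj₂ λ v →
    let w , v~w = ¬∀⟶∃¬ (n H) _ (λ w → adj H v w Bool.≟ false) (λ v≁ → ¬isolated (v , v≁))
    in w , ¬-not v~w

  complete-or-nonadjacent : Complete H ⊎ ∃₂ λ u v → u ≢ v × adj H u v ≡ false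
  complete-or-nonadjacent with any? (λ u → any? (λ v → ¬? (u ≟ v) ×-dec adj H u v Bool.≟ false))
  ... | yes (u , v , u≢v , u≁v) = inj₂ (u , v , u≢v , u≁v)
  ... | no ¬nonadjacent = inj₁ λ u v u≢v → ¬-not (λ u≁v → ¬nonadjacent (u , v , u≢v , u≁v))

  walk-first-step : ∀ {u v} → Reach H u v → u ≢ v → ∃ λ w → adj H u w ≡ true
  walk-first-step here         u≢u = contradiction refl u≢u
  walk-first-step (step u~w _) _   = _ , u~w

  connected⇒NoIsolatedVertex : ∀ {v₀ v₁} → Connected H → v₀ ≢ v₁ → NoIsolatedVertex H
  connected⇒NoIsolatedVertex {v₀} {v₁} conn v₀≢v₁ v with v ≟ v₀
  ... | yes refl = walk-first-step (conn v v₁) v₀≢v₁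
  ... | no v≢v₀  = walk-first-step (conn v v₀) v≢v₀

  walk⇒InducedP₃ : ∀ {u v} → Reach H u v → u ≢ v → adj H u v ≡ false → InducedP₃ H
  walk⇒InducedP₃ here u≢u _ = contradiction refl u≢u
  walk⇒InducedP₃ {u} {v} (step {v = w} u~w w⇝v) u≢v u≁v with w ≟ v | adj H w v in w~?v
  ... | yes refl | _    = contradiction u≁v (not-¬ u~w)
  ... | no w≢v  | true  = record { a = u ; b = w ; c = v ; a~b = u~w ; b~c = w~?v ; a≢c = u≢v ; a≁c = u≁v }
  ... | no w≢v  | false = walk⇒InducedP₃ w⇝v w≢v w~?v

  Independent-⁅⁆ : ∀ {g} → Independent H ⁅ g ⁆
  Independent-⁅⁆ {g} g₁∈ g₂∈ rewrite x∈⁅y⁆⇒x≡y g g₁∈ | x∈⁅y⁆⇒x≡y g g₂∈ = adj-irrefl H g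

  Independent-∪⁅⁆ : ∀ {I h} → Independent H I → (∀ g → g ∈ I → adj H h g ≡ false) →
                    Independent H (I ∪ ⁅ h ⁆)
  Independent-∪⁅⁆ {I} {h} indI h≁I {g} {g′} g∈ g′∈ with x∈p∪q⁻ I ⁅ h ⁆ g∈ | x∈p∪q⁻ I ⁅ h ⁆ g′∈
  ... | inj₁ g∈I | inj₁ g′∈I = indI g∈I g′∈I
  ... | inj₁ g∈I | inj₂ g′∈h rewrite x∈⁅y⁆⇒x≡y h g′∈h = trans (adj-sym H g h) (h≁I g g∈I)
  ... | inj₂ g∈h | inj₁ g′∈I rewrite x∈⁅y⁆⇒x≡y h g∈h  = h≁I g′ g′∈I
  ... | inj₂ g∈h | inj₂ g′∈h rewrite x∈⁅y⁆⇒x≡y h g∈h | x∈⁅y⁆⇒x≡y h g′∈h = adj-irrefl H h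

  independent⇒∃maximal⊇ : ∀ {I} → Independent H I → ∃ λ J → I ⊆ J × Independent H J × Dominating H J
  independent⇒∃maximal⊇ = grow (⊃-wellFounded _)
    where
    grow : ∀ {I} → Acc _⊃_ I → Independent H I → ∃ λ J → I ⊆ J × Independent H J × Dominating H J
    grow {I} (acc larger) indI
      with any? (λ h → ¬? (h ∈? I) ×-dec all? (λ g → g ∈? I →-dec adj H h g Bool.≟ false))
    ... | yes (h , h∉I , h≁I) =
      let I⊂I∪h : I ⊂ I ∪ ⁅ h ⁆
          I⊂I∪h = p⊆p∪q ⁅ h ⁆ , h , q⊆p∪q I ⁅ h ⁆ (x∈⁅x⁆ h) , h∉I
          J , I∪h⊆J , indJ , domJ = grow (larger I⊂I∪h) (Independent-∪⁅⁆ indI h≁I)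
      in J , (λ g∈I → I∪h⊆J (p⊆p∪q ⁅ h ⁆ g∈I)) , indJ , domJ
    ... | no maximal = I , id , indI , dominating
      where
      dominating : Dominating H I
      dominating h with h ∈? I
      ... | yes h∈I = inj₁ h∈I
      ... | no  h∉I with any? (λ g → g ∈? I ×-dec adj H h g Bool.≟ true)
      ... | yes neighbour = inj₂ neighbour
      ... | no  isolated  =
        contradiction (h , h∉I , λ g g∈I → ¬-not (λ h~g → isolated (g , g∈I , h~g))) maximal

  complete⇒Dominating-⁅⁆ : ∀ {g} → Complete H → Dominating H ⁅ g ⁆
  complete⇒Dominating-⁅⁆ {g} complete h with h ≟ g
  ... | yes refl = inj₁ (x∈⁅x⁆ h)
  ... | no  h≢g  = inj₂ (g , x∈⁅x⁆ g , complete h g h≢g)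

module LexProduct (G F : Graph) where

  G[F] : Graph
  G[F] = lex G F

  private variable
    g g′ h : Fin (n G)
    f f′ t : Fin (n F)
    I      : Subset (n G)
    T T′   : Subset (n F)
    S S′   : Subset (n G * n F)

  ⟨_,_⟩ : Fin (n G) → Fin (n F) → Fin (n G * n F)
  ⟨ g , f ⟩ = combine g f

  layer : Subset (n G * n F) → Fin (n G) → Subset (n F)
  layer S g = tabulate λ f → lookup S ⟨ g , f ⟩

  coordinates : (v : Fin (n G * n F)) → ∃₂ λ (g : Fin (n G)) (f : Fin (n F)) → ⟨ g , f ⟩ ≡ v
  coordinates = combine-surjective {n G} {n F}

  ⊆-⟨,⟩ : (∀ {g : Fin (n G)} {f : Fin (n F)} → ⟨ g , f ⟩ ∈ S → ⟨ g , f ⟩ ∈ S′) → S ⊆ S′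
  ⊆-⟨,⟩ S⊆T {x} x∈S with coordinates x
  ... | g , f , refl = S⊆T x∈S

  -- Opaque, so that I and T can be inferred from the type of a proof of x ∈ I ⊗ T.
  opaque
    _⊗_ : Subset (n G) → Subset (n F) → Subset (n G * n F)
    I ⊗ T = map _∧_ I ⊛* T

    lookup-⊗ : ∀ I T g f → lookup (I ⊗ T) ⟨ g , f ⟩ ≡ lookup I g ∧ lookup T f
    lookup-⊗ I T g f = trans (lookup-⊛* (map _∧_ I) T g f) (cong (λ h → h (lookup T f)) (lookup-map g _∧_ I))

  ∈-⊗⁺ : g ∈ I → f ∈ T → ⟨ g , f ⟩ ∈ I ⊗ T
  ∈-⊗⁺ {g} {I} {f} {T} g∈I f∈T =
    lookup⇒[]= _ (I ⊗ T) (trans (lookup-⊗ I T g f) (cong₂ _∧_ ([]=⇒lookup g∈I) ([]=⇒lookup f∈T)))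

  ∈-⊗⁻ : ⟨ g , f ⟩ ∈ I ⊗ T → g ∈ I × f ∈ T
  ∈-⊗⁻ {g} {f} {I} {T} x∈
    with lookup I g in g∈I | lookup T f in f∈T | trans (sym (lookup-⊗ I T g f)) ([]=⇒lookup x∈)
  ... | true | true | _ = lookup⇒[]= g I g∈I , lookup⇒[]= f T f∈T

  ∈-layer⁺ : ⟨ g , f ⟩ ∈ S → f ∈ layer S g
  ∈-layer⁺ x∈S = ∈-tabulate⁺ ([]=⇒lookup x∈S)

  ∈-layer⁻ : f ∈ layer S g → ⟨ g , f ⟩ ∈ S
  ∈-layer⁻ {S = S} f∈ = lookup⇒[]= _ S (∈-tabulate⁻ f∈)

  adj-⟨,⟩ : ∀ g f g′ f′ →
            adj G[F] ⟨ g , f ⟩ ⟨ g′ , f′ ⟩ ≡ adj G g g′ ∨ (⌊ g ≟ g′ ⌋ ∧ adj F f f′)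
  adj-⟨,⟩ g f g′ f′ = cong₂ (lexAdj₀ G F) (remQuot-combine g f) (remQuot-combine g′ f′)

  adjᴳ⇒adj : ∀ f f′ → adj G g g′ ≡ true → adj G[F] ⟨ g , f ⟩ ⟨ g′ , f′ ⟩ ≡ true
  adjᴳ⇒adj {g} {g′} f f′ g~g′ rewrite adj-⟨,⟩ g f g′ f′ | g~g′ = refl

  adjᶠ⇒adj : ∀ g → adj F f f′ ≡ true → adj G[F] ⟨ g , f ⟩ ⟨ g , f′ ⟩ ≡ true
  adjᶠ⇒adj {f} {f′} g f~f′ rewrite adj-⟨,⟩ g f g f′ | adj-irrefl G g with g ≟ g
  ... | yes _   = f~f′
  ... | no g≢g = contradiction refl g≢g

  adj⇒ : ∀ g f g′ f′ → adj G[F] ⟨ g , f ⟩ ⟨ g′ , f′ ⟩ ≡ true →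
         adj G g g′ ≡ true ⊎ (g ≡ g′ × adj F f f′ ≡ true)
  adj⇒ g f g′ f′ x~y rewrite adj-⟨,⟩ g f g′ f′ with adj G g g′ | g ≟ g′
  ... | true  | _        = inj₁ refl
  ... | false | yes g≡g′ = inj₂ (g≡g′ , x~y)

  NoIsolatedVertex-lex : NoIsolatedVertex G → NoIsolatedVertex G[F]
  NoIsolatedVertex-lex noIsolatedG v with coordinates v
  ... | g , f , refl = let g′ , g~g′ = noIsolatedG g in ⟨ g′ , f ⟩ , adjᴳ⇒adj f f g~g′

  ∣S∣≡∑∣layer∣ : ∀ S → ∣ S ∣ ≡ ∑[ g < n G ] ∣ layer S g ∣
  ∣S∣≡∑∣layer∣ S = begin
    ∣ S ∣                                             ≡⟨ ∣p∣≡∑𝟙 S ⟩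
    ∑[ x < n G * n F ] 𝟙 (lookup S x)                 ≡⟨ ∑-combine (n G) _ ⟩
    ∑[ g < n G ] ∑[ f < n F ] 𝟙 (lookup S ⟨ g , f ⟩) ≡⟨ sum-cong-≗ (λ g → sym (∣tabulate∣≡∑𝟙 (lookup S ∘ ⟨ g ,_⟩))) ⟩
    ∑[ g < n G ] ∣ layer S g ∣                        ∎
    where open ≡-Reasoning

  ∣I⊗T∣≡∣I∣*∣T∣ : ∀ I T → ∣ I ⊗ T ∣ ≡ ∣ I ∣ * ∣ T ∣
  ∣I⊗T∣≡∣I∣*∣T∣ I T = begin
    ∣ I ⊗ T ∣                                                    ≡⟨ ∣S∣≡∑∣layer∣ (I ⊗ T) ⟩
    ∑[ g < n G ] ∣ layer (I ⊗ T) g ∣                             ≡⟨ sum-cong-≗ ∣layer∣ ⟩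
    ∑[ g < n G ] (𝟙 (lookup I g) * ∑[ f < n F ] 𝟙 (lookup T f)) ≡⟨ *-distribʳ-sum _ (𝟙 ∘ lookup I) ⟨
    (∑[ g < n G ] 𝟙 (lookup I g)) * ∑[ f < n F ] 𝟙 (lookup T f) ≡⟨ cong₂ _*_ (∣p∣≡∑𝟙 I) (∣p∣≡∑𝟙 T) ⟨
    ∣ I ∣ * ∣ T ∣                                                ∎
    where
    open ≡-Reasoning
    ∣layer∣ : ∀ g → ∣ layer (I ⊗ T) g ∣ ≡ 𝟙 (lookup I g) * ∑[ f < n F ] 𝟙 (lookup T f)
    ∣layer∣ g = begin
      ∣ layer (I ⊗ T) g ∣                          ≡⟨ ∣tabulate∣≡∑𝟙 (lookup (I ⊗ T) ∘ ⟨ g ,_⟩) ⟩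
      ∑[ f < n F ] 𝟙 (lookup (I ⊗ T) ⟨ g , f ⟩)    ≡⟨ sum-cong-≗ (cong 𝟙 ∘ lookup-⊗ I T g) ⟩
      ∑[ f < n F ] 𝟙 (lookup I g ∧ lookup T f)     ≡⟨ ∑𝟙-∧ (lookup I g) (lookup T) ⟩
      𝟙 (lookup I g) * ∑[ f < n F ] 𝟙 (lookup T f) ∎

  ∣⁅g⁆⊗T∣≡∣T∣ : ∀ g T → ∣ ⁅ g ⁆ ⊗ T ∣ ≡ ∣ T ∣
  ∣⁅g⁆⊗T∣≡∣T∣ g T = trans (∣I⊗T∣≡∣I∣*∣T∣ ⁅ g ⁆ T) (trans (cong (_* ∣ T ∣) (∣⁅x⁆∣≡1 g)) (+-identityʳ _))

  ∣I⊗⁅f⁆∣≡∣I∣ : ∀ I f → ∣ I ⊗ ⁅ f ⁆ ∣ ≡ ∣ I ∣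
  ∣I⊗⁅f⁆∣≡∣I∣ I f = trans (∣I⊗T∣≡∣I∣*∣T∣ I ⁅ f ⁆) (trans (cong (∣ I ∣ *_) (∣⁅x⁆∣≡1 f)) (*-identityʳ _))

  ⊗-IsTDS : Dominating G I → IsTDS F T → IsTDS G[F] (I ⊗ T)
  ⊗-IsTDS domI tdsT v with coordinates v
  ... | g , f , refl with tdsT f | domI g
  ... | t , t∈T , f~t | inj₁ g∈I                = ⟨ g , t ⟩ , ∈-⊗⁺ g∈I t∈T , adjᶠ⇒adj g f~t
  ... | t , t∈T , _   | inj₂ (g′ , g′∈I , g~g′) = ⟨ g′ , t ⟩ , ∈-⊗⁺ g′∈I t∈T , adjᴳ⇒adj f t g~g′

  ⊗-IsMinimalTDS : Independent G I → Dominating G I → IsMinimalTDS F T → IsMinimalTDS G[F] (I ⊗ T)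
  ⊗-IsMinimalTDS {I} {T} indI domI (tdsT , minT) =
    irremovable⇒IsMinimalTDS G[F] (⊗-IsTDS domI tdsT) irremovable
    where
    irremovable : ∀ {x} → x ∈ I ⊗ T → ¬ IsTDS G[F] (I ⊗ T - x)
    irremovable {x} x∈ tds with coordinates x
    ... | g , f , refl with ∈-⊗⁻ x∈
    ... | g∈I , f∈T = minT (T - f) (x∈p⇒p-x⊂p f∈T) tds-f
      where
      tds-f : IsTDS F (T - f)
      tds-f f′ with tds ⟨ g , f′ ⟩
      ... | w , w∈ , ~w with coordinates w
      ... | g′ , t , refl with ∈-⊗⁻ (p─q⊆p _ _ w∈) | adj⇒ g f′ g′ t ~w
      ... | g′∈I , _   | inj₁ g~g′          = contradiction (indI g∈I g′∈I) (not-¬ g~g′)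
      ... | _    , t∈T | inj₂ (refl , f′~t) = t , x∈p∧x≢y⇒x∈p-y t∈T (x∈p-y⇒x≢y _ w∈ ∘ cong ⟨ g ,_⟩) , f′~t

  ⊗⁅⁆-IsMinimalTDS : ∀ {D} f₀ → IsMinimalTDS G D → IsMinimalTDS G[F] (D ⊗ ⁅ f₀ ⁆)
  ⊗⁅⁆-IsMinimalTDS {D} f₀ (tdsD , minD) = irremovable⇒IsMinimalTDS G[F] tds irremovable
    where
    tds : IsTDS G[F] (D ⊗ ⁅ f₀ ⁆)
    tds v with coordinates v
    ... | g , f , refl = let d , d∈D , g~d = tdsD g in ⟨ d , f₀ ⟩ , ∈-⊗⁺ d∈D (x∈⁅x⁆ f₀) , adjᴳ⇒adj f f₀ g~d
    irremovable : ∀ {x} → x ∈ D ⊗ ⁅ f₀ ⁆ → ¬ IsTDS G[F] (D ⊗ ⁅ f₀ ⁆ - x)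
    irremovable {x} x∈ tds-x with coordinates x
    ... | d , f , refl with ∈-⊗⁻ x∈
    ... | d∈D , f∈⁅f₀⁆ with refl ← x∈⁅y⁆⇒x≡y f₀ f∈⁅f₀⁆ = minD (D - d) (x∈p⇒p-x⊂p d∈D) tds-d
      where
      tds-d : IsTDS G (D - d)
      tds-d g with tds-x ⟨ g , f₀ ⟩
      ... | w , w∈ , ~w with coordinates w
      ... | d′ , t , refl with ∈-⊗⁻ (p─q⊆p _ _ w∈)
      ... | d′∈D , t∈⁅f₀⁆ with refl ← x∈⁅y⁆⇒x≡y f₀ t∈⁅f₀⁆ with adj⇒ g f₀ d′ f₀ ~w
      ... | inj₁ g~d′        = d′ , x∈p∧x≢y⇒x∈p-y d′∈D (x∈p-y⇒x≢y _ w∈ ∘ cong ⟨_, f₀ ⟩) , g~d′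
      ... | inj₂ (_ , f₀~f₀) = contradiction refl (adj⇒≢ F f₀~f₀)

  proj : Subset (n G * n F) → Subset (n G)
  proj S = tabulate λ g → does (nonempty? (layer S g))

  ∈-proj⁺ : ⟨ g , f ⟩ ∈ S → g ∈ proj S
  ∈-proj⁺ x∈S = ∈-tabulate⁺ (dec-true (nonempty? _) (_ , ∈-layer⁺ x∈S))

  ∈-proj⁻ : g ∈ proj S → ∃ λ f → ⟨ g , f ⟩ ∈ S
  ∈-proj⁻ {g} {S} g∈
    with nonempty? (layer S g) | ∈-tabulate⁻ {p = λ g → does (nonempty? (layer S g))} g∈
  ... | yes (f , f∈) | _ = f , ∈-layer⁻ f∈

  module _ {f₀ : Fin (n F)} (isolated : ∀ f → adj F f₀ f ≡ false) where

    proj-IsTDS : IsTDS G[F] S → IsTDS G (proj S)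
    proj-IsTDS tds h with tds ⟨ h , f₀ ⟩
    ... | w , w∈S , ~w with coordinates w
    ... | g , f , refl with adj⇒ h f₀ g f ~w
    ... | inj₁ h~g        = g , ∈-proj⁺ w∈S , h~g
    ... | inj₂ (_ , f₀~f) = contradiction (isolated f) (not-¬ f₀~f)

    minimal⇒layer⊆⁅⁆ : IsMinimalTDS G[F] S → ⟨ g , f ⟩ ∈ S → layer S g ⊆ ⁅ f ⁆
    minimal⇒layer⊆⁅⁆ {S} {g} {f} (tdsS , minS) x∈S {f′} f′∈ with f′ ≟ f
    ... | yes refl = x∈⁅x⁆ f
    ... | no f′≢f  = contradiction tds-y (minS (S - y) (x∈p⇒p-x⊂p y∈S))
      where
      y = ⟨ g , f′ ⟩
      y∈S = ∈-layer⁻ f′∈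
      x≢y : ⟨ g , f ⟩ ≢ y
      x≢y x≡y = f′≢f (sym (proj₂ (combine-injective g f g f′ x≡y)))
      -- A G-neighbour of y is also dominated by ⟨ g , f ⟩; a vertex over g itself by some vertex
      -- of S over a G-neighbour of g, which exists because the layer over f₀ is dominated only via G.
      tds-y : IsTDS G[F] (S - y)
      tds-y v with tdsS v
      ... | w , w∈S , v~w with w ≟ y
      ... | no w≢y   = w , x∈p∧x≢y⇒x∈p-y w∈S w≢y , v~w
      ... | yes refl with coordinates v
      ... | h , e , refl with adj⇒ h e g f′ v~w
      ... | inj₁ h~g        = ⟨ g , f ⟩ , x∈p∧x≢y⇒x∈p-y x∈S x≢y , adjᴳ⇒adj e f h~g
      ... | inj₂ (refl , _) =
        let g″ , g″∈ , g~g″ = proj-IsTDS tdsS g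
            z , z∈S         = ∈-proj⁻ g″∈
        in ⟨ g″ , z ⟩ , x∈p∧x≢y⇒x∈p-y z∈S (adj⇒≢ G g~g″ ∘ sym ∘ proj₁ ∘ combine-injective g″ z g f′) ,
           adjᴳ⇒adj e z g~g″

    ∣layer∣≡𝟙 : IsMinimalTDS G[F] S → ∀ g → ∣ layer S g ∣ ≡ 𝟙 (does (nonempty? (layer S g)))
    ∣layer∣≡𝟙 {S} minS g with nonempty? (layer S g)
    ... | yes (f , f∈) =
      trans (cong ∣_∣ (⊆-antisym (minimal⇒layer⊆⁅⁆ minS (∈-layer⁻ f∈)) (x∈p⇒⁅x⁆⊆p f∈))) (∣⁅x⁆∣≡1 f)
    ... | no empty = trans (cong ∣_∣ (Empty-unique empty)) (∣⊥∣≡0 (n F))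

    minimal⇒∣S∣≡∣proj∣ : IsMinimalTDS G[F] S → ∣ S ∣ ≡ ∣ proj S ∣
    minimal⇒∣S∣≡∣proj∣ {S} minS =
      trans (∣S∣≡∑∣layer∣ S)
            (trans (sum-cong-≗ (∣layer∣≡𝟙 minS)) (sym (∣tabulate∣≡∑𝟙 λ g → does (nonempty? (layer S g)))))

    proj-IsMinimalTDS : IsMinimalTDS G[F] S → IsMinimalTDS G (proj S)
    proj-IsMinimalTDS {S} (tdsS , minS) = proj-IsTDS tdsS , λ T (T⊆ , x , x∈ , x∉T) tdsT →
      let z , z∈S = ∈-proj⁻ x∈
      in minS (S ∩ T ⊗ ⊤) (p∩q⊆p S _ , ⟨ x , z ⟩ , z∈S , x∉T ∘ proj₁ ∘ ∈-⊗⁻ ∘ p∩q⊆q S _)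
              (restriction-IsTDS tdsT T⊆)
      where
      restriction-IsTDS : ∀ {T} → IsTDS G T → T ⊆ proj S → IsTDS G[F] (S ∩ T ⊗ ⊤)
      restriction-IsTDS tdsT T⊆ v with coordinates v
      ... | h , e , refl =
        let q , q∈T , h~q = tdsT h
            z , z∈S       = ∈-proj⁻ (T⊆ q∈T)
        in ⟨ q , z ⟩ , x∈p∩q⁺ (z∈S , ∈-⊗⁺ q∈T ∈⊤) , adjᴳ⇒adj e z h~q

  isolated⇒uniform⇔ : MinDegreeZero F → ∀ {k} → UniformTDS G[F] k ⇔ UniformTDS G k
  isolated⇒uniform⇔ (f₀ , isolated) = mk⇔
    (λ uniform D minD → trans (sym (∣I⊗⁅f⁆∣≡∣I∣ D f₀)) (uniform _ (⊗⁅⁆-IsMinimalTDS f₀ minD)))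
    (λ uniform S minS →
       trans (minimal⇒∣S∣≡∣proj∣ isolated minS) (uniform _ (proj-IsMinimalTDS isolated minS)))

  ⊗-⊂ʳ : g ∈ I → T′ ⊂ T → I ⊗ T′ ⊂ I ⊗ T
  ⊗-⊂ʳ {g} g∈I (T′⊆T , t , t∈T , t∉T′) =
    ⊆-⟨,⟩ (λ x∈ → ∈-⊗⁺ (proj₁ (∈-⊗⁻ x∈)) (T′⊆T (proj₂ (∈-⊗⁻ x∈)))) ,
    ⟨ g , t ⟩ , ∈-⊗⁺ g∈I t∈T , t∉T′ ∘ proj₂ ∘ ∈-⊗⁻

  ⁅g⁆⊗layer⊆ : ∀ S → ⁅ g ⁆ ⊗ layer S g ⊆ S
  ⁅g⁆⊗layer⊆ {g} S = ⊆-⟨,⟩ ⊆S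
    where
    ⊆S : ⟨ g′ , f ⟩ ∈ ⁅ g ⁆ ⊗ layer S g → ⟨ g′ , f ⟩ ∈ S
    ⊆S x∈ with g′∈⁅g⁆ , f∈ ← ∈-⊗⁻ x∈ with refl ← x∈⁅y⁆⇒x≡y g g′∈⁅g⁆ = ∈-layer⁻ f∈

  module _ (complete : Complete G) where

    pair-IsTDS : g ≢ g′ → IsTDS G[F] (⁅ ⟨ g , f ⟩ ⁆ ∪ ⁅ ⟨ g′ , f′ ⟩ ⁆)
    pair-IsTDS {g} {g′} {f} {f′} g≢g′ v with coordinates v
    ... | h , e , refl with h ≟ g
    ... | yes refl = ⟨ g′ , f′ ⟩ , q⊆p∪q _ _ (x∈⁅x⁆ _) , adjᴳ⇒adj e f′ (complete h g′ g≢g′)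
    ... | no  h≢g  = ⟨ g , f ⟩ , p⊆p∪q _ (x∈⁅x⁆ _) , adjᴳ⇒adj e f (complete h g h≢g)

    ⁅g⁆⊗-IsMinimalTDS : IsMinimalTDS F T → IsMinimalTDS G[F] (⁅ g ⁆ ⊗ T)
    ⁅g⁆⊗-IsMinimalTDS = ⊗-IsMinimalTDS (Independent-⁅⁆ G) (complete⇒Dominating-⁅⁆ G complete)

    minimal-across-layers : IsMinimalTDS G[F] S → ⟨ g , f ⟩ ∈ S → ⟨ g′ , f′ ⟩ ∈ S → g ≢ g′ → ∣ S ∣ ≡ 2
    minimal-across-layers {S} {g} {f} {g′} {f′} minS x∈S y∈S g≢g′ =
      trans (cong ∣_∣ (sym (minimal⇒TDS⊆-≡ G[F] minS pair⊆S tds))) (proj₂ (pair-IsTDS⇒minimal G[F] _ _ tds))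
      where
      tds = pair-IsTDS {f = f} {f′ = f′} g≢g′
      pair⊆S : ⁅ ⟨ g , f ⟩ ⁆ ∪ ⁅ ⟨ g′ , f′ ⟩ ⁆ ⊆ S
      pair⊆S z∈ with x∈p∪q⁻ _ _ z∈
      ... | inj₁ z∈⁅x⁆ = x∈p⇒⁅x⁆⊆p x∈S z∈⁅x⁆
      ... | inj₂ z∈⁅y⁆ = x∈p⇒⁅x⁆⊆p y∈S z∈⁅y⁆

    minimal-within-layer : IsMinimalTDS G[F] S → (∀ {g′ f′} → ⟨ g′ , f′ ⟩ ∈ S → g′ ≡ g) →
                           IsMinimalTDS F (layer S g) × ∣ S ∣ ≡ ∣ layer S g ∣
    minimal-within-layer {S} {g} (tdsS , minS) within =
      (tdsT , λ T′ T′⊂T tdsT′ → minS (⁅ g ⁆ ⊗ T′)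
                                     (subst (⁅ g ⁆ ⊗ T′ ⊂_) S≡ (⊗-⊂ʳ (x∈⁅x⁆ g) T′⊂T))
                                     (⊗-IsTDS (complete⇒Dominating-⁅⁆ G complete) tdsT′)) ,
      trans (cong ∣_∣ (sym S≡)) (∣⁅g⁆⊗T∣≡∣T∣ g (layer S g))
      where
      S≡ : ⁅ g ⁆ ⊗ layer S g ≡ S
      S≡ = ⊆-antisym (⁅g⁆⊗layer⊆ S) (⊆-⟨,⟩ S⊆)
        where
        S⊆ : ⟨ g′ , f ⟩ ∈ S → ⟨ g′ , f ⟩ ∈ ⁅ g ⁆ ⊗ layer S g
        S⊆ x∈S with refl ← within x∈S = ∈-⊗⁺ (x∈⁅x⁆ g) (∈-layer⁺ x∈S)
      tdsT : IsTDS F (layer S g)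
      tdsT f with tdsS ⟨ g , f ⟩
      ... | w , w∈S , ~w with coordinates w
      ... | g″ , t , refl with within w∈S | adj⇒ g f g″ t ~w
      ... | refl | inj₁ g~g  = contradiction refl (adj⇒≢ G g~g)
      ... | refl | inj₂ (_ , f~t) = t , ∈-layer⁺ w∈S , f~t

    minimal-pair-or-layer : Fin (n G * n F) → IsMinimalTDS G[F] S →
                            ∣ S ∣ ≡ 2 ⊎ ∃ λ T → IsMinimalTDS F T × ∣ S ∣ ≡ ∣ T ∣
    minimal-pair-or-layer {S} v₀ minS with proj₁ minS v₀
    ... | x , x∈S , _ with coordinates x
    ... | g , f , refl with any? (λ g′ → any? (λ f′ → ⟨ g′ , f′ ⟩ ∈? S ×-dec ¬? (g′ ≟ g)))
    ... | yes (g′ , f′ , y∈S , g′≢g) = inj₁ (minimal-across-layers minS x∈S y∈S (g′≢g ∘ sym))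
    ... | no  within = inj₂ (layer S g , minimal-within-layer minS same-layer)
      where
      same-layer : ∀ {g′ f′} → ⟨ g′ , f′ ⟩ ∈ S → g′ ≡ g
      same-layer {g′} {f′} y∈S with g′ ≟ g
      ... | yes g′≡g = g′≡g
      ... | no  g′≢g = contradiction (g′ , f′ , y∈S , g′≢g) within

    uniform⇒uniformᶠ : ∀ {k} → Fin (n G) → UniformTDS G[F] k → UniformTDS F k
    uniform⇒uniformᶠ g uniform T minT = trans (sym (∣⁅g⁆⊗T∣≡∣T∣ g T)) (uniform _ (⁅g⁆⊗-IsMinimalTDS minT))

    uniform⇒≡2 : ∀ {k} → g ≢ g′ → Fin (n F) → UniformTDS G[F] k → k ≡ 2
    uniform⇒≡2 g≢g′ f uniform =
      let minP , ∣P∣≡2 = pair-IsTDS⇒minimal G[F] _ _ (pair-IsTDS {f = f} {f′ = f} g≢g′)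
      in trans (sym (uniform _ minP)) ∣P∣≡2

    uniformᶠ⇒uniform : Fin (n G * n F) → UniformTDS F 2 → UniformTDS G[F] 2
    uniformᶠ⇒uniform v₀ uniform S minS with minimal-pair-or-layer v₀ minS
    ... | inj₁ ∣S∣≡2              = ∣S∣≡2
    ... | inj₂ (T , minT , ∣S∣≡∣T∣) = trans ∣S∣≡∣T∣ (uniform T minT)

  module _ (P : InducedP₃ G) where
    open InducedP₃ P

    P₃ : Subset (n G)
    P₃ = ⁅ a ⁆ ∪ ⁅ b ⁆ ∪ ⁅ c ⁆

    collapsed : Subset (n G) → Subset (n F) → Fin (n F) → Subset (n G * n F)
    collapsed I T y = (I - a - c) ⊗ T ∪ P₃ ⊗ ⁅ y ⁆

    a∈P₃ : a ∈ P₃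
    a∈P₃ = p⊆p∪q _ (x∈⁅x⁆ a)

    b∈P₃ : b ∈ P₃
    b∈P₃ = q⊆p∪q ⁅ a ⁆ _ (p⊆p∪q _ (x∈⁅x⁆ b))

    c∈P₃ : c ∈ P₃
    c∈P₃ = q⊆p∪q ⁅ a ⁆ _ (q⊆p∪q ⁅ b ⁆ _ (x∈⁅x⁆ c))

    on-P₃ : ∀ {I T y} → g ∈ P₃ → ⟨ g , y ⟩ ∈ collapsed I T y
    on-P₃ {I = I} {T} g∈P₃ = q⊆p∪q ((I - a - c) ⊗ T) _ (∈-⊗⁺ g∈P₃ (x∈⁅x⁆ _))

    off-P₃ : ∀ {I T y} → g ∈ I → g ≢ a → g ≢ c → t ∈ T → ⟨ g , t ⟩ ∈ collapsed I T y
    off-P₃ g∈I g≢a g≢c t∈T = p⊆p∪q _ (∈-⊗⁺ (x∈p∧x≢y⇒x∈p-y (x∈p∧x≢y⇒x∈p-y g∈I g≢a) g≢c) t∈T)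

    collapsed-IsTDS : ∀ {I T} y → Dominating G I → IsTDS F T → IsTDS G[F] (collapsed I T y)
    collapsed-IsTDS {I} {T} y domI tdsT v with coordinates v
    ... | h , e , refl with h ≟ a | h ≟ b | h ≟ c
    ... | yes refl | _        | _        = ⟨ b , y ⟩ , on-P₃ b∈P₃ , adjᴳ⇒adj e y a~b
    ... | no _     | yes refl | _        = ⟨ a , y ⟩ , on-P₃ a∈P₃ , adjᴳ⇒adj e y (trans (adj-sym G b a) a~b)
    ... | no _     | no _     | yes refl = ⟨ b , y ⟩ , on-P₃ b∈P₃ , adjᴳ⇒adj e y (trans (adj-sym G c b) b~c)
    ... | no h≢a   | no _     | no h≢c with tdsT e | domI h
    ... | t , t∈T , e~t | inj₁ h∈I              = ⟨ h , t ⟩ , off-P₃ h∈I h≢a h≢c t∈T , adjᶠ⇒adj h e~t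
    ... | t , t∈T , _   | inj₂ (g , g∈I , h~g) with g ≟ a | g ≟ c
    ... | yes refl | _        = ⟨ a , y ⟩ , on-P₃ a∈P₃ , adjᴳ⇒adj e y h~g
    ... | no _     | yes refl = ⟨ c , y ⟩ , on-P₃ c∈P₃ , adjᴳ⇒adj e y h~g
    ... | no g≢a   | no g≢c   = ⟨ g , t ⟩ , off-P₃ g∈I g≢a g≢c t∈T , adjᴳ⇒adj e t h~g

    ∣collapsed∣<∣I⊗T∣ : ∀ {I T} y → a ∈ I → c ∈ I → 2 ≤ ∣ T ∣ → ∣ collapsed I T y ∣ < ∣ I ⊗ T ∣
    ∣collapsed∣<∣I⊗T∣ {I} {T} y a∈I c∈I 2≤∣T∣ = begin-strict
      ∣ collapsed I T y ∣                  ≤⟨ ∣p∪q∣≤∣p∣+∣q∣ ((I - a - c) ⊗ T) (P₃ ⊗ ⁅ y ⁆) ⟩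
      ∣ (I - a - c) ⊗ T ∣ + ∣ P₃ ⊗ ⁅ y ⁆ ∣ ≡⟨ cong₂ _+_ (∣I⊗T∣≡∣I∣*∣T∣ _ T) (∣I⊗⁅f⁆∣≡∣I∣ P₃ y) ⟩
      r * ∣ T ∣ + ∣ P₃ ∣                   ≤⟨ +-monoʳ-≤ (r * ∣ T ∣) ∣P₃∣≤3 ⟩
      r * ∣ T ∣ + 3                        <⟨ +-monoʳ-< (r * ∣ T ∣) (+-mono-≤ 2≤∣T∣ 2≤∣T∣) ⟩
      r * ∣ T ∣ + (∣ T ∣ + ∣ T ∣)          ≡⟨ +-comm (r * ∣ T ∣) _ ⟩
      ∣ T ∣ + ∣ T ∣ + r * ∣ T ∣            ≡⟨ +-assoc ∣ T ∣ ∣ T ∣ _ ⟩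
      (2 + r) * ∣ T ∣                      ≤⟨ *-monoˡ-≤ ∣ T ∣ 2+r≤∣I∣ ⟩
      ∣ I ∣ * ∣ T ∣                        ≡⟨ ∣I⊗T∣≡∣I∣*∣T∣ I T ⟨
      ∣ I ⊗ T ∣                            ∎
      where
      open ≤-Reasoning
      r = ∣ I - a - c ∣
      2+r≤∣I∣ : 2 + r ≤ ∣ I ∣
      2+r≤∣I∣ = ≤-trans (s≤s (x∈p⇒∣p-x∣<∣p∣ (x∈p∧x≢y⇒x∈p-y c∈I (a≢c ∘ sym)))) (x∈p⇒∣p-x∣<∣p∣ a∈I)
      ∣P₃∣≤3 : ∣ P₃ ∣ ≤ 3
      ∣P₃∣≤3 = ≤-trans (∣p∪q∣≤∣p∣+∣q∣ ⁅ a ⁆ _) (+-mono-≤ (≤-reflexive (∣⁅x⁆∣≡1 a)) (∣⁅x⁆∪⁅y⁆∣≤2 b c))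

  InducedP₃⇒¬uniform : InducedP₃ G → Fin (n F) → NoIsolatedVertex F → ∀ {k} → ¬ UniformTDS G[F] k
  InducedP₃⇒¬uniform P y noIsolatedF uniform =
    let T , minT                = NoIsolatedVertex⇒∃minimal F noIsolatedF
        I , ac⊆I , indI , domI = independent⇒∃maximal⊇ G ac-independent
        M , M⊆ , minM          = IsTDS⇒∃minimal⊆ G[F] (collapsed-IsTDS P y domI (proj₁ minT))
    in <-irrefl (trans (uniform M minM) (sym (uniform (I ⊗ T) (⊗-IsMinimalTDS indI domI minT))))
                (≤-<-trans (p⊆q⇒∣p∣≤∣q∣ M⊆)
                           (∣collapsed∣<∣I⊗T∣ P y (ac⊆I a∈ac) (ac⊆I c∈ac) (IsTDS⇒2≤∣S∣ F y (proj₁ minT))))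
    where
    open InducedP₃ P
    a∈ac = p⊆p∪q ⁅ c ⁆ (x∈⁅x⁆ a)
    c∈ac = q⊆p∪q ⁅ a ⁆ ⁅ c ⁆ (x∈⁅x⁆ c)
    ac-independent : Independent G (⁅ a ⁆ ∪ ⁅ c ⁆)
    ac-independent = Independent-∪⁅⁆ G (Independent-⁅⁆ G)
      λ g g∈⁅a⁆ → subst (λ g → adj G c g ≡ false) (sym (x∈⁅y⁆⇒x≡y a g∈⁅a⁆)) (trans (adj-sym G c a) a≁c)

theorem3p12 : (G F : Graph) → Connected G → 2 ≤ n G → 2 ≤ n F →
    WellTotalDominated (lex G F) ⇔
      ((Complete G × WellTotalDominated F × GammaT F 2)
       ⊎ (WellTotalDominated G × MinDegreeZero F))
theorem3p12 G F connected 2≤∣G∣ 2≤∣F∣ with two-distinct 2≤∣G∣ | two-distinct 2≤∣F∣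
... | g₀ , g₁ , g₀≢g₁ | f₀ , _ = mk⇔ forward backward
  where
  open LexProduct G F
  noIsolatedG  = connected⇒NoIsolatedVertex G connected g₀≢g₁
  noIsolatedGF = NoIsolatedVertex-lex noIsolatedG

  forward : WellTotalDominated G[F] →
            (Complete G × WellTotalDominated F × GammaT F 2) ⊎ (WellTotalDominated G × MinDegreeZero F)
  forward well
    with WellTotalDominated⇒uniform G[F] well | isolated-or-NoIsolatedVertex F | complete-or-nonadjacent G
  ... | _ , uniform | inj₁ isolated | _ =
    let uniformG = Equivalence.to (isolated⇒uniform⇔ isolated) uniform
    in inj₂ (uniform⇒WellTotalDominated G noIsolatedG uniformG , isolated)
  ... | _ , uniform | inj₂ noIsolatedF | inj₁ complete =
    let uniformF = subst (UniformTDS F) (uniform⇒≡2 complete g₀≢g₁ f₀ uniform)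
                                        (uniform⇒uniformᶠ complete g₀ uniform)
    in inj₁ (complete , uniform⇒WellTotalDominated F noIsolatedF uniformF , uniform⇒GammaT F noIsolatedF uniformF)
  ... | _ , uniform | inj₂ noIsolatedF | inj₂ (u , v , u≢v , u≁v) =
    contradiction uniform (InducedP₃⇒¬uniform (walk⇒InducedP₃ G (connected u v) u≢v u≁v) f₀ noIsolatedF)

  backward : (Complete G × WellTotalDominated F × GammaT F 2) ⊎ (WellTotalDominated G × MinDegreeZero F) →
             WellTotalDominated G[F]
  backward (inj₁ (complete , wellF , (T , minT , ∣T∣≡2) , _)) =
    let _ , uniformF = WellTotalDominated⇒uniform F wellF
        uniformF₂    = subst (UniformTDS F) (trans (sym (uniformF T minT)) ∣T∣≡2) uniformF
    in uniform⇒WellTotalDominated G[F] noIsolatedGF (uniformᶠ⇒uniform complete ⟨ g₀ , f₀ ⟩ uniformF₂)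
  backward (inj₂ (wellG , isolated)) =
    let _ , uniformG = WellTotalDominated⇒uniform G wellG
    in uniform⇒WellTotalDominated G[F] noIsolatedGF (Equivalence.from (isolated⇒uniform⇔ isolated) uniformG)
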